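{- A $(0,1)$-matrix $A$ is nested if and only if $A$ does not contain the $0$-gem $\begin{pmatrix}1&1&0\\0&1&1\end{pmatrix}$ as a submatrix, where containment is up to permuting the rows and columns of the chosen $2\times3$ submatrix.
   Context: Identify each row of a $(0,1)$-matrix with the set of columns in which it has a $1$. Two rows are disjoint if these sets are disjoint and nested if one set contains the other. A $(0,1)$-matrix has the consecutive-ones property for the rows if there is a permutation of its columns such that in every row the $1$'s appear consecutively. A $(0,1)$-matrix $A$ is nested if it has the consecutive-ones property for the rows and every two rows of $A$ are disjoint or nested. -}

module Defs where

open import Data.Nat using (ℕ)
open import Data.Fin using (Fin; zero; suc; _≤_)
open import Data.Bool using (Bool; true; false)
open import Data.Product using (Σ; _×_; ∃-syntax)
open import Data.Sum using (_⊎_)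
open import Data.Empty using (⊥)
open import Relation.Binary.PropositionalEquality using (_≡_)
open import Function.Definitions using (Injective)
open import Function.Bundles using (_↔_; Inverse)

-- A (0,1)-matrix with m rows and n columns; true = 1, false = 0.
Matrix01 : ℕ → ℕ → Set
Matrix01 m n = Fin m → Fin n → Bool

-- Consecutive-ones property for the rows: there is a permutation σ of the
-- columns (position p holds original column σ p) such that in every row the
-- 1's occupy consecutive positions.
ConsecutiveOnesRows : ∀ {m n} → Matrix01 m n → Set
ConsecutiveOnesRows {m} {n} A =
  Σ (Fin n ↔ Fin n) λ σ →
    ∀ (i : Fin m) (p q r : Fin n) → p ≤ q → q ≤ r →
      A i (Inverse.to σ p) ≡ true → A i (Inverse.to σ r) ≡ true →
      A i (Inverse.to σ q) ≡ true

DisjointRows : ∀ {m n} → Matrix01 m n → Fin m → Fin m → Set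
DisjointRows A i j = ∀ c → A i c ≡ true → A j c ≡ true → ⊥

SubsetRows : ∀ {m n} → Matrix01 m n → Fin m → Fin m → Set
SubsetRows A i j = ∀ c → A i c ≡ true → A j c ≡ true

DisjointOrNested : ∀ {m n} → Matrix01 m n → Fin m → Fin m → Set
DisjointOrNested A i j = DisjointRows A i j ⊎ (SubsetRows A i j ⊎ SubsetRows A j i)

Nested : ∀ {m n} → Matrix01 m n → Set
Nested {m} A = ConsecutiveOnesRows A × (∀ (i j : Fin m) → DisjointOrNested A i j)

zeroGem : Matrix01 2 3
zeroGem zero zero = true
zeroGem zero (suc zero) = true
zeroGem zero (suc (suc zero)) = false
zeroGem (suc zero) zero = false
zeroGem (suc zero) (suc zero) = true
zeroGem (suc zero) (suc (suc zero)) = true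

ContainsZeroGem : ∀ {m n} → Matrix01 m n → Set
ContainsZeroGem {m} {n} A =
  Σ (Fin 2 → Fin m) λ ρ → Σ (Fin 3 → Fin n) λ κ →
  Σ (Fin 2 ↔ Fin 2) λ π → Σ (Fin 3 ↔ Fin 3) λ τ →
    (Injective _≡_ _≡_ ρ × Injective _≡_ _≡_ κ ×
     (∀ (a : Fin 2) (b : Fin 3) →
        A (ρ (Inverse.to π a)) (κ (Inverse.to τ b)) ≡ zeroGem a b))

-- A zero-gem consists of two rows that overlap without being nested, so excluding it is the
-- same as requiring the rows to form a laminar family. A laminar family has the
-- consecutive-ones property: list the rows in lexicographically decreasing order, which puts
-- every row after all rows containing it, and sort the columns lexicographically by their
-- entries in that row order. Every row earlier than R is then constant on the support of R,
-- so any two columns in the support of R agree up to the position of R, and by the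
-- lexicographic order so does every column sorted between them.
module Submission where

open import Defs
open import Level using (Level)
open import Data.Nat using (ℕ; zero; suc; z≤n; s≤s)
open import Data.Fin using (Fin; zero; suc; _≤_; punchIn)
open import Data.Fin.Properties using (any?) renaming (_≟_ to _≟ᶠ_)
open import Data.Fin.Permutation using (Permutation′; id; insert; _⟨$⟩ʳ_; _⟨$⟩ˡ_; inverseʳ)
open import Data.Bool using (Bool; true; false; b≤b; f≤t)
import Data.Bool.Properties as Bool
open import Data.Vec using (Vec; _∷_; lookup; tabulate)
open import Data.Vec.Properties using (lookup∘tabulate)
open import Data.Vec.Relation.Binary.Lex.NonStrict as Lex using (Lex-≤; base; this; next)
open import Data.Product using (Σ-syntax; ∃-syntax; _×_; _,_; uncurry)
open import Data.Sum using (inj₁; inj₂; reduce)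
open import Data.Empty using (⊥-elim)
open import Function using (_∘_; flip)
open import Function.Bundles using (_⇔_; mk⇔; Inverse)
open import Function.Construct.Identity using (↔-id)
open import Function.Definitions using (Injective)
open import Relation.Binary.Core using (Rel)
open import Relation.Binary.Definitions using (Total; Transitive; Antisymmetric)
open import Relation.Binary.PropositionalEquality
  using (_≡_; _≢_; refl; sym; trans; cong; cong₂; subst; module ≡-Reasoning)
open import Relation.Nullary using (¬_; Dec; yes; no; contradiction; _×-dec_)

private
  variable
    ℓ : Level
    m n : ℕ

∃-minimum : ∀ {k} {_≲_ : Rel (Fin (suc k)) ℓ} → Total _≲_ → Transitive _≲_ →
            ∃[ a ] (∀ x → a ≲ x)
∃-minimum {k = zero} total trans = zero , λ { zero → reduce (total zero zero) }
∃-minimum {k = suc k} total trans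
  with b , b-min ← ∃-minimum {k = k} (λ x y → total (suc x) (suc y)) trans
  with total zero (suc b)
... | inj₁ 0≲b = zero , λ { zero → reduce (total zero zero) ; (suc x) → trans 0≲b (b-min x) }
... | inj₂ b≲0 = suc b , λ { zero → b≲0 ; (suc x) → b-min x }

sortingPermutation : ∀ {n} {_≲_ : Rel (Fin n) ℓ} → Total _≲_ → Transitive _≲_ →
                     Σ[ σ ∈ Permutation′ n ] (∀ {p q} → p ≤ q → (σ ⟨$⟩ʳ p) ≲ (σ ⟨$⟩ʳ q))
sortingPermutation {n = zero} _ _ = id , λ { {()} }
sortingPermutation {n = suc n} {_≲_ = _≲_} total trans
  with a , a-min ← ∃-minimum total trans
  with σ , σ-sorted ← sortingPermutation {_≲_ = λ x y → punchIn a x ≲ punchIn a y}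
                                         (λ x y → total _ _) trans
  = insert zero a σ , monotone
  where
  monotone : ∀ {p q} → p ≤ q → (insert zero a σ ⟨$⟩ʳ p) ≲ (insert zero a σ ⟨$⟩ʳ q)
  monotone {zero}  {q}     _          = a-min _
  monotone {suc p} {suc q} (s≤s p≤q) = σ-sorted p≤q

module _ {a} {A : Set a} {_≼_ : Rel A ℓ} (≼-antisym : Antisymmetric _≡_ _≼_) where

  private
    head-squeeze : ∀ {m n o x y z} {xs : Vec A m} {ys : Vec A n} {zs : Vec A o} →
                   Lex-≤ _≡_ _≼_ (x ∷ xs) (y ∷ ys) → Lex-≤ _≡_ _≼_ (y ∷ ys) (z ∷ zs) →
                   x ≡ z → y ≡ x
    head-squeeze (next x≡y _)       _                  _    = sym x≡y
    head-squeeze (this (x≼y , _) _) (this (y≼z , _) _) refl = ≼-antisym y≼z x≼y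
    head-squeeze (this _ _)         (next y≡z _)       refl = y≡z

  lex-squeeze : ∀ {n} {u v w : Vec A n} → Lex-≤ _≡_ _≼_ u v → Lex-≤ _≡_ _≼_ v w →
                ∀ k → (∀ j → j ≤ k → lookup u j ≡ lookup w j) → lookup v k ≡ lookup u k
  lex-squeeze {u = _ ∷ _} {_ ∷ _} {_ ∷ _} u≤v v≤w zero agree =
    head-squeeze u≤v v≤w (agree zero z≤n)
  lex-squeeze {u = _ ∷ _} {_ ∷ _} {_ ∷ _} u≤v@(this (_ , x≢y) _) v≤w (suc k) agree =
    contradiction (sym (head-squeeze u≤v v≤w (agree zero z≤n))) x≢y
  lex-squeeze (next x≡y _) (this (_ , y≢z) _) (suc k) agree =
    contradiction (trans (sym x≡y) (agree zero z≤n)) y≢z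
  lex-squeeze (next _ u≤v) (next _ v≤w) (suc k) agree =
    lex-squeeze u≤v v≤w k (λ j j≤k → agree (suc j) (s≤s j≤k))

infix 4 _≤ˡᵉˣ_

_≤ˡᵉˣ_ : Vec Bool n → Vec Bool n → Set
_≤ˡᵉˣ_ = Lex-≤ _≡_ Data.Bool._≤_

≤ˡᵉˣ-total : Total (_≤ˡᵉˣ_ {n})
≤ˡᵉˣ-total = Lex.≤-total sym Bool._≟_ Bool.≤-antisym Bool.≤-total

≤ˡᵉˣ-trans : Transitive (_≤ˡᵉˣ_ {n})
≤ˡᵉˣ-trans = Lex.≤-trans Bool.≤-isPartialOrder

≤ˡᵉˣ∧⊇⇒≡ : {u v : Vec Bool n} → u ≤ˡᵉˣ v →
           (∀ i → lookup v i ≡ true → lookup u i ≡ true) → u ≡ v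
≤ˡᵉˣ∧⊇⇒≡ (base _)             _   = refl
≤ˡᵉˣ∧⊇⇒≡ (this (b≤b , x≢x) _) _   = contradiction refl x≢x
≤ˡᵉˣ∧⊇⇒≡ (this (f≤t , _) _)   v⊆u with () ← v⊆u zero refl
≤ˡᵉˣ∧⊇⇒≡ (next refl u≤v)      v⊆u = cong (_ ∷_) (≤ˡᵉˣ∧⊇⇒≡ u≤v (v⊆u ∘ suc))

Laminar : Matrix01 m n → Set
Laminar {m} A = ∀ (i j : Fin m) → DisjointOrNested A i j

row : Matrix01 m n → Fin m → Vec Bool n
row A i = tabulate (A i)

module _ {A : Matrix01 m n} (laminar : Laminar A) where

  laminar⇒¬zeroGem : ¬ ContainsZeroGem A
  laminar⇒¬zeroGem (ρ , κ , π , τ , _ , _ , gem)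
    with laminar (ρ (Inverse.to π zero)) (ρ (Inverse.to π (suc zero)))
  ... | inj₁ disjoint = disjoint _ (gem zero (suc zero)) (gem (suc zero) (suc zero))
  ... | inj₂ (inj₁ 0⊆1) with () ← trans (sym (0⊆1 _ (gem zero zero))) (gem (suc zero) zero)
  ... | inj₂ (inj₂ 1⊆0) with () ← trans (sym (1⊆0 _ (gem (suc zero) (suc (suc zero)))))
                                         (gem zero (suc (suc zero)))

  constant-on-support : ∀ {R T c e} → row A R ≤ˡᵉˣ row A T →
                        A R c ≡ true → A R e ≡ true → A T c ≡ A T e
  constant-on-support {R} {T} {c} {e} R≤T Rc Re with laminar T R
  ... | inj₁ disjoint       = trans (outside c Rc) (sym (outside e Re))
    where
    outside : ∀ x → A R x ≡ true → A T x ≡ false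
    outside x Rx = Bool.¬-not (λ Tx → disjoint x Tx Rx)
  ... | inj₂ (inj₂ R⊆T)     = trans (R⊆T c Rc) (sym (R⊆T e Re))
  ... | inj₂ (inj₁ T⊆R)     = trans (R⊆T c Rc) (sym (R⊆T e Re))
    where
    open ≡-Reasoning
    lookup-row : ∀ i x → lookup (row A i) x ≡ A i x
    lookup-row i = lookup∘tabulate (A i)
    R≡T : row A R ≡ row A T
    R≡T = ≤ˡᵉˣ∧⊇⇒≡ R≤T λ x Tx → begin
      lookup (row A R) x  ≡⟨ lookup-row R x ⟩
      A R x               ≡⟨ T⊆R x (trans (sym (lookup-row T x)) Tx) ⟩
      true                ∎
    R⊆T : SubsetRows A R T
    R⊆T x Rx = begin
      A T x               ≡⟨ lookup-row T x ⟨
      lookup (row A T) x  ≡⟨ cong (λ r → lookup r x) R≡T ⟨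
      lookup (row A R) x  ≡⟨ lookup-row R x ⟩
      A R x               ≡⟨ Rx ⟩
      true                ∎

  module _ (ρ : Permutation′ m)
           (ρ-sorted : ∀ {j k} → j ≤ k → row A (ρ ⟨$⟩ʳ k) ≤ˡᵉˣ row A (ρ ⟨$⟩ʳ j)) where

    column : Fin n → Vec Bool m
    column c = tabulate λ k → A (ρ ⟨$⟩ʳ k) c

    lookup-column : ∀ c k → lookup (column c) k ≡ A (ρ ⟨$⟩ʳ k) c
    lookup-column c = lookup∘tabulate (λ k → A (ρ ⟨$⟩ʳ k) c)

    consecutiveOnes-from-rowOrder : ConsecutiveOnesRows A
    consecutiveOnes-from-rowOrder
      with κ , κ-sorted ← sortingPermutation {_≲_ = λ c d → column c ≤ˡᵉˣ column d}
                                             (λ c d → ≤ˡᵉˣ-total (column c) (column d)) ≤ˡᵉˣ-trans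
      = κ , consecutive
      where
      open ≡-Reasoning
      consecutive : ∀ i p q r → p ≤ q → q ≤ r →
                    A i (κ ⟨$⟩ʳ p) ≡ true → A i (κ ⟨$⟩ʳ r) ≡ true → A i (κ ⟨$⟩ʳ q) ≡ true
      consecutive i p q r p≤q q≤r ip ir = begin
        A i (κ ⟨$⟩ʳ q)                ≡⟨ cong (λ x → A x (κ ⟨$⟩ʳ q)) ρk≡i ⟨
        A (ρ ⟨$⟩ʳ k) (κ ⟨$⟩ʳ q)       ≡⟨ lookup-column _ k ⟨
        lookup (column (κ ⟨$⟩ʳ q)) k  ≡⟨ lex-squeeze Bool.≤-antisym (κ-sorted p≤q) (κ-sorted q≤r)
                                                     k earlier-agree ⟩
        lookup (column (κ ⟨$⟩ʳ p)) k  ≡⟨ lookup-column _ k ⟩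
        A (ρ ⟨$⟩ʳ k) (κ ⟨$⟩ʳ p)       ≡⟨ cong (λ x → A x (κ ⟨$⟩ʳ p)) ρk≡i ⟩
        A i (κ ⟨$⟩ʳ p)                ≡⟨ ip ⟩
        true                          ∎
        where
        k : Fin m
        k = ρ ⟨$⟩ˡ i
        ρk≡i : ρ ⟨$⟩ʳ k ≡ i
        ρk≡i = inverseʳ ρ
        earlier-agree : ∀ j → j ≤ k → lookup (column (κ ⟨$⟩ʳ p)) j ≡ lookup (column (κ ⟨$⟩ʳ r)) j
        earlier-agree j j≤k = begin
          lookup (column (κ ⟨$⟩ʳ p)) j  ≡⟨ lookup-column _ j ⟩
          A (ρ ⟨$⟩ʳ j) (κ ⟨$⟩ʳ p)       ≡⟨ constant-on-support i≤j ip ir ⟩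
          A (ρ ⟨$⟩ʳ j) (κ ⟨$⟩ʳ r)       ≡⟨ lookup-column _ j ⟨
          lookup (column (κ ⟨$⟩ʳ r)) j  ∎
          where
          i≤j : row A i ≤ˡᵉˣ row A (ρ ⟨$⟩ʳ j)
          i≤j = subst (λ x → row A x ≤ˡᵉˣ row A (ρ ⟨$⟩ʳ j)) ρk≡i (ρ-sorted j≤k)

  laminar⇒consecutiveOnes : ConsecutiveOnesRows A
  laminar⇒consecutiveOnes = uncurry consecutiveOnes-from-rowOrder
    (sortingPermutation {_≲_ = λ i j → row A j ≤ˡᵉˣ row A i}
                        (λ i j → ≤ˡᵉˣ-total (row A j) (row A i)) (flip ≤ˡᵉˣ-trans))

zeroGemColumn : Fin 3 → Bool × Bool
zeroGemColumn b = zeroGem zero b , zeroGem (suc zero) b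

zeroGemColumn-injective : Injective _≡_ _≡_ zeroGemColumn
zeroGemColumn-injective {zero}           {zero}           _ = refl
zeroGemColumn-injective {suc zero}       {suc zero}       _ = refl
zeroGemColumn-injective {suc (suc zero)} {suc (suc zero)} _ = refl
zeroGemColumn-injective {zero}           {suc zero}       ()
zeroGemColumn-injective {zero}           {suc (suc zero)} ()
zeroGemColumn-injective {suc zero}       {zero}           ()
zeroGemColumn-injective {suc zero}       {suc (suc zero)} ()
zeroGemColumn-injective {suc (suc zero)} {zero}           ()
zeroGemColumn-injective {suc (suc zero)} {suc zero}       ()

overlapping⇒containsZeroGem : ∀ {A : Matrix01 m n} {i j c₁ c₂ c₃} → i ≢ j →
  A i c₁ ≡ true → A j c₁ ≡ false → A i c₂ ≡ true → A j c₂ ≡ true →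
  A i c₃ ≡ false → A j c₃ ≡ true → ContainsZeroGem A
overlapping⇒containsZeroGem {A = A} {i} {j} {c₁} {c₂} {c₃} i≢j i₁ j₁ i₂ j₂ i₃ j₃ =
  ρ , κ , ↔-id _ , ↔-id _ , ρ-injective , κ-injective , gem
  where
  open ≡-Reasoning
  ρ : Fin 2 → Fin _
  ρ zero       = i
  ρ (suc zero) = j
  κ : Fin 3 → Fin _
  κ zero             = c₁
  κ (suc zero)       = c₂
  κ (suc (suc zero)) = c₃
  gem : ∀ a b → A (ρ a) (κ b) ≡ zeroGem a b
  gem zero       zero             = i₁
  gem zero       (suc zero)       = i₂
  gem zero       (suc (suc zero)) = i₃
  gem (suc zero) zero             = j₁
  gem (suc zero) (suc zero)       = j₂
  gem (suc zero) (suc (suc zero)) = j₃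
  ρ-injective : Injective _≡_ _≡_ ρ
  ρ-injective {zero}     {zero}     _   = refl
  ρ-injective {zero}     {suc zero} i≡j = contradiction i≡j i≢j
  ρ-injective {suc zero} {zero}     j≡i = contradiction (sym j≡i) i≢j
  ρ-injective {suc zero} {suc zero} _   = refl
  submatrixColumn : Fin 3 → Bool × Bool
  submatrixColumn b = A i (κ b) , A j (κ b)
  submatrixColumn≡zeroGemColumn : ∀ b → submatrixColumn b ≡ zeroGemColumn b
  submatrixColumn≡zeroGemColumn b = cong₂ _,_ (gem zero b) (gem (suc zero) b)
  κ-injective : Injective _≡_ _≡_ κ
  κ-injective {b} {b′} κb≡κb′ = zeroGemColumn-injective (begin
    zeroGemColumn b     ≡⟨ submatrixColumn≡zeroGemColumn b ⟨
    submatrixColumn b   ≡⟨ cong (λ c → A i c , A j c) κb≡κb′ ⟩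
    submatrixColumn b′  ≡⟨ submatrixColumn≡zeroGemColumn b′ ⟩
    zeroGemColumn b′    ∎)

module _ {A : Matrix01 m n} where

  private
    inDifference? : ∀ i j c → Dec (A i c ≡ true × A j c ≡ false)
    inDifference? i j c = A i c Bool.≟ true ×-dec A j c Bool.≟ false

    inIntersection? : ∀ i j c → Dec (A i c ≡ true × A j c ≡ true)
    inIntersection? i j c = A i c Bool.≟ true ×-dec A j c Bool.≟ true

    ¬difference⇒⊆ : ∀ {i j} → ¬ (∃[ c ] (A i c ≡ true × A j c ≡ false)) → SubsetRows A i j
    ¬difference⇒⊆ ∄ c ic = Bool.¬-not λ jc → ∄ (c , ic , jc)

  ¬zeroGem⇒laminar : ¬ ContainsZeroGem A → Laminar A
  ¬zeroGem⇒laminar ¬gem i j with i ≟ᶠ j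
  ... | yes refl = inj₂ (inj₁ λ _ Aic → Aic)
  ... | no i≢j with any? (inDifference? i j) | any? (inDifference? j i) | any? (inIntersection? i j)
  ...   | no ∄  | _     | _    = inj₂ (inj₁ (¬difference⇒⊆ ∄))
  ...   | yes _ | no ∄  | _    = inj₂ (inj₂ (¬difference⇒⊆ ∄))
  ...   | yes _ | yes _ | no ∄ = inj₁ λ c ic jc → ∄ (c , ic , jc)
  ...   | yes (c₁ , i₁ , j₁) | yes (c₃ , j₃ , i₃) | yes (c₂ , i₂ , j₂) =
    ⊥-elim (¬gem (overlapping⇒containsZeroGem {A = A} i≢j i₁ j₁ i₂ j₂ i₃ j₃))

mainTheorem2 : ∀ {m n : ℕ} (A : Matrix01 m n) → Nested A ⇔ (¬ ContainsZeroGem A)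
mainTheorem2 A = mk⇔ (λ (_ , laminar) → laminar⇒¬zeroGem laminar) nested
  where
  nested : ¬ ContainsZeroGem A → Nested A
  nested ¬gem = laminar⇒consecutiveOnes laminar , laminar
    where
    laminar : Laminar A
    laminar = ¬zeroGem⇒laminar ¬gem
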